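{- For all integers $N\ge0$, $\Delta(2N)=\Delta(4N)$.
   Context: The Stern sequence $(s(n))_{n\ge0}$ is defined by $s(0)=0$, $s(1)=1$, $s(2n)=s(n)$, $s(2n+1)=s(n)+s(n+1)$. For $N\ge0$ and $i\in\{1,2\}$, let $T(N;3,i)=|\{n: 0\le n<N,\ s(n)\equiv i\pmod 3\}|$ (so $T(0;3,i)=0$), and let $\Delta(N)=T(N;3,1)-T(N;3,2)$. -}

module Defs where

open import Data.Nat using (ℕ; zero; suc; _+_; _*_; _%_; _/_; _≡ᵇ_)
open import Data.Integer using (ℤ; +_; _-_)
open import Data.Product using (_×_; _,_; proj₁)

-- sternPair k n = (s(n), s(n+1)) whenever the fuel k exceeds n.
-- Uses s(2m) = s(m), s(2m+1) = s(m) + s(m+1).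
sternPair : ℕ → ℕ → ℕ × ℕ
sternPair zero    n = (0 , 1)
sternPair (suc k) zero = (0 , 1)
sternPair (suc k) (suc n) with sternPair k ((suc n) / 2)
... | (a , b) with (suc n) % 2
...   | zero = (a , a + b)
...   | suc _ = (a + b , b)

s : ℕ → ℕ
s n = proj₁ (sternPair (suc n) n)

T : ℕ → ℕ → ℕ
T zero    i = 0
T (suc N) i = T N i + (if (s N % 3) ≡ᵇ i then 1 else 0)
  where open import Data.Bool using (if_then_else_)

Δ : ℕ → ℤ
Δ N = + T N 1 - + T N 2

{-# OPTIONS --safe #-}
-- With χ₃(x) = (x/3) the Legendre symbol, Δ(N) = Σ_{n<N} χ₃(s(n)).  Since
-- s(2m) = s(m) and s(2m+1) = s(m) + s(m+1), with a = s(m) and b = s(m+1) the block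
-- [2m, 2m+2) contributes χ₃(a) + χ₃(a+b) to Δ, while the block [4m, 4m+4)
-- contributes χ₃(a) + χ₃(2a+b) + χ₃(a+b) + χ₃(a+2b).  As (2a+b) + (a+2b) ≡ 0 (mod 3)
-- and χ₃ is odd, the two extra terms cancel, so both blocks contribute the same and
-- induction on N gives Δ(2N) = Δ(4N).
module Submission where

open import Defs
open import Data.Bool using (if_then_else_)
open import Data.Nat
  using (ℕ; zero; suc; pred; _+_; _*_; _%_; _/_; _≡ᵇ_; _<_; s≤s; z≤n)
open import Data.Nat.Properties using (*-suc; *-comm; *-assoc; <-≤-trans; n<1+n; m≤n*m)
open import Data.Nat.DivMod
  using (m/n<m; m*n/n≡m; /-congˡ; +-distrib-/-∣ʳ; %-remove-+ʳ; %-distribˡ-+; m%n%n≡m%n; m%n<n)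
open import Data.Nat.Divisibility using (_∣_; divides; m∣m*n; n∣m⇒m%n≡0)
open import Data.Nat.Induction using (<-rec)
open import Data.Nat.Tactic.RingSolver as ℕ-Solver using ()
open import Data.Integer using (ℤ; +_; _-_; 0ℤ) renaming (_+_ to _+ℤ_)
open import Data.Integer.Properties using (pos-+; +-identityʳ; +-assoc)
open import Data.Integer.Tactic.RingSolver as ℤ-Solver using ()
open import Data.Product using (_×_; _,_; proj₁; proj₂)
open import Relation.Binary.PropositionalEquality
  using (_≡_; refl; sym; trans; cong; cong₂; subst; module ≡-Reasoning)
open ≡-Reasoning

[2*m]/2≡m : ∀ m → 2 * m / 2 ≡ m
[2*m]/2≡m m = trans (/-congˡ (*-comm 2 m)) (m*n/n≡m m 2)

[2*m]%2≡0 : ∀ m → 2 * m % 2 ≡ 0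
[2*m]%2≡0 m = n∣m⇒m%n≡0 (2 * m) 2 (m∣m*n {2} m)

[1+2*m]/2≡m : ∀ m → (1 + 2 * m) / 2 ≡ m
[1+2*m]/2≡m m = trans (+-distrib-/-∣ʳ 1 (m∣m*n {2} m)) ([2*m]/2≡m m)

[1+2*m]%2≡1 : ∀ m → (1 + 2 * m) % 2 ≡ 1
[1+2*m]%2≡1 m = %-remove-+ʳ 1 (m∣m*n {2} m)

sternStep : ℕ × ℕ → ℕ → ℕ × ℕ
sternStep (a , b) zero    = (a , a + b)
sternStep (a , b) (suc _) = (a + b , b)

sternPair-suc : ∀ k n →
  sternPair (suc k) (suc n) ≡ sternStep (sternPair k (suc n / 2)) (suc n % 2)
sternPair-suc k n with sternPair k (suc n / 2) | suc n % 2
... | (a , b) | zero  = refl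
... | (a , b) | suc _ = refl

[1+n]/2<1+n : ∀ n → suc n / 2 < suc n
[1+n]/2<1+n n = m/n<m (suc n) 2 (s≤s (s≤s z≤n))

sternPair-fuel-irrelevant : ∀ {k j} n → n < k → n < j → sternPair k n ≡ sternPair j n
sternPair-fuel-irrelevant {suc k} {suc j} zero    _         _         = refl
sternPair-fuel-irrelevant {suc k} {suc j} (suc n) (s≤s n<k) (s≤s n<j) = begin
  sternPair (suc k) (suc n)               ≡⟨ sternPair-suc k n ⟩
  sternStep (sternPair k h) (suc n % 2)   ≡⟨ cong (λ p → sternStep p (suc n % 2)) (sternPair-fuel-irrelevant h h<k h<j) ⟩
  sternStep (sternPair j h) (suc n % 2)   ≡⟨ sternPair-suc j n ⟨
  sternPair (suc j) (suc n)               ∎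
  where
  h : ℕ
  h = suc n / 2
  h<k : h < k
  h<k = <-≤-trans ([1+n]/2<1+n n) n<k
  h<j : h < j
  h<j = <-≤-trans ([1+n]/2<1+n n) n<j

sternPairAt : ℕ → ℕ × ℕ
sternPairAt n = sternPair (suc n) n

sternPairAt-suc : ∀ n → sternPairAt (suc n) ≡ sternStep (sternPairAt (suc n / 2)) (suc n % 2)
sternPairAt-suc n = trans (sternPair-suc (suc n) n)
  (cong (λ p → sternStep p (suc n % 2)) (sternPair-fuel-irrelevant (suc n / 2) ([1+n]/2<1+n n) (n<1+n _)))

sternPairAt-even : ∀ m → sternPairAt (2 * m) ≡ sternStep (sternPairAt m) 0
sternPairAt-even zero    = refl
sternPairAt-even (suc m) = trans (sternPairAt-suc (pred (2 * suc m)))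
  (cong₂ sternStep (cong sternPairAt ([2*m]/2≡m (suc m))) ([2*m]%2≡0 (suc m)))

sternPairAt-odd : ∀ m → sternPairAt (1 + 2 * m) ≡ sternStep (sternPairAt m) 1
sternPairAt-odd m = trans (sternPairAt-suc (2 * m))
  (cong₂ sternStep (cong sternPairAt ([1+2*m]/2≡m m)) ([1+2*m]%2≡1 m))

s-double : ∀ n → s (2 * n) ≡ s n
s-double n = cong proj₁ (sternPairAt-even n)

data EvenOrOdd : ℕ → Set where
  even : ∀ m → EvenOrOdd (2 * m)
  odd  : ∀ m → EvenOrOdd (1 + 2 * m)

evenOrOdd : ∀ n → EvenOrOdd n
evenOrOdd zero = even 0
evenOrOdd (suc n) with evenOrOdd n
... | even m = odd m
... | odd m  = subst EvenOrOdd (*-suc 2 m) (even (suc m))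

sternPairAt-snd : ∀ n → proj₂ (sternPairAt n) ≡ s (suc n)
sternPairAt-snd = <-rec (λ n → proj₂ (sternPairAt n) ≡ s (suc n)) go
  where
  go : ∀ n → (∀ {m} → m < n → proj₂ (sternPairAt m) ≡ s (suc m)) → proj₂ (sternPairAt n) ≡ s (suc n)
  go n rec with evenOrOdd n
  ... | even m = trans (cong proj₂ (sternPairAt-even m)) (sym (cong proj₁ (sternPairAt-odd m)))
  ... | odd m  = begin
    proj₂ (sternPairAt (1 + 2 * m)) ≡⟨ cong proj₂ (sternPairAt-odd m) ⟩
    proj₂ (sternPairAt m)           ≡⟨ rec (s≤s (m≤n*m m 2)) ⟩
    s (suc m)                       ≡⟨ s-double (suc m) ⟨
    s (2 * suc m)                   ≡⟨ cong s (*-suc 2 m) ⟩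
    s (2 + 2 * m)                   ∎

s-double+1 : ∀ n → s (1 + 2 * n) ≡ s n + s (suc n)
s-double+1 n = trans (cong proj₁ (sternPairAt-odd n)) (cong (λ b → s n + b) (sternPairAt-snd n))

s-double+1≡neighbours : ∀ n → s (1 + 2 * n) ≡ s (2 * n) + s (2 + 2 * n)
s-double+1≡neighbours n = begin
  s (1 + 2 * n)               ≡⟨ s-double+1 n ⟩
  s n + s (suc n)             ≡⟨ cong₂ _+_ (s-double n) (s-double (suc n)) ⟨
  s (2 * n) + s (2 * suc n)   ≡⟨ cong (λ k → s (2 * n) + s k) (*-suc 2 n) ⟩
  s (2 * n) + s (2 + 2 * n)   ∎

3∣[x+y]+[y+z] : ∀ x y z → y ≡ x + z → 3 ∣ (x + y) + (y + z)
3∣[x+y]+[y+z] x _ z refl = divides (x + z) (sum≡[x+z]*3 x z)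
  where
  sum≡[x+z]*3 : ∀ x z → (x + (x + z)) + ((x + z) + z) ≡ (x + z) * 3
  sum≡[x+z]*3 = ℕ-Solver.solve-∀

χ₃ : ℕ → ℤ
χ₃ x = + (if x % 3 ≡ᵇ 1 then 1 else 0) - + (if x % 3 ≡ᵇ 2 then 1 else 0)

χ₃-cancel-residues : ∀ r t → r < 3 → t < 3 → (r + t) % 3 ≡ 0 → χ₃ r +ℤ χ₃ t ≡ 0ℤ
χ₃-cancel-residues 0 0 _ _ _  = refl
χ₃-cancel-residues 1 2 _ _ _  = refl
χ₃-cancel-residues 2 1 _ _ _  = refl
χ₃-cancel-residues 0 1 _ _ ()
χ₃-cancel-residues 0 2 _ _ ()
χ₃-cancel-residues 1 0 _ _ ()
χ₃-cancel-residues 1 1 _ _ ()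
χ₃-cancel-residues 2 0 _ _ ()
χ₃-cancel-residues 2 2 _ _ ()
χ₃-cancel-residues (suc (suc (suc _))) _ (s≤s (s≤s (s≤s ()))) _ _
χ₃-cancel-residues _ (suc (suc (suc _))) _ (s≤s (s≤s (s≤s ()))) _

χ₃-cancel : ∀ x y → 3 ∣ x + y → χ₃ x +ℤ χ₃ y ≡ 0ℤ
χ₃-cancel x y 3∣x+y = begin
  χ₃ x +ℤ χ₃ y               ≡⟨ cong₂ _+ℤ_ (χ₃-mod x) (χ₃-mod y) ⟨
  χ₃ (x % 3) +ℤ χ₃ (y % 3)   ≡⟨ χ₃-cancel-residues (x % 3) (y % 3) (m%n<n x 3) (m%n<n y 3) residues-sum ⟩
  0ℤ                         ∎
  where
  χ₃-mod : ∀ z → χ₃ (z % 3) ≡ χ₃ z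
  χ₃-mod z = cong (λ r → + (if r ≡ᵇ 1 then 1 else 0) - + (if r ≡ᵇ 2 then 1 else 0)) (m%n%n≡m%n z 3)
  residues-sum : (x % 3 + y % 3) % 3 ≡ 0
  residues-sum = trans (sym (%-distribˡ-+ x y 3)) (n∣m⇒m%n≡0 (x + y) 3 3∣x+y)

+[m+n]-+[o+p] : ∀ m n o p → + (m + n) - + (o + p) ≡ (+ m - + o) +ℤ (+ n - + p)
+[m+n]-+[o+p] m n o p = begin
  + (m + n) - + (o + p)               ≡⟨ cong₂ _-_ (pos-+ m n) (pos-+ o p) ⟩
  (+ m +ℤ + n) - (+ o +ℤ + p)         ≡⟨ interchange (+ m) (+ n) (+ o) (+ p) ⟩
  (+ m - + o) +ℤ (+ n - + p)          ∎
  where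
  interchange : ∀ (a b c d : ℤ) → (a +ℤ b) - (c +ℤ d) ≡ (a - c) +ℤ (b - d)
  interchange = ℤ-Solver.solve-∀

Δ-suc : ∀ N → Δ (suc N) ≡ Δ N +ℤ χ₃ (s N)
Δ-suc N = +[m+n]-+[o+p] (T N 1) _ (T N 2) _

Δ-double-suc : ∀ k → Δ (2 * suc k) ≡ Δ (2 * k) +ℤ (χ₃ (s k) +ℤ χ₃ (s k + s (suc k)))
Δ-double-suc k = begin
  Δ (2 * suc k)                                             ≡⟨ cong Δ (*-suc 2 k) ⟩
  Δ (2 + 2 * k)                                             ≡⟨ Δ-suc (1 + 2 * k) ⟩
  Δ (1 + 2 * k) +ℤ χ₃ (s (1 + 2 * k))                       ≡⟨ cong (_+ℤ χ₃ (s (1 + 2 * k))) (Δ-suc (2 * k)) ⟩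
  (Δ (2 * k) +ℤ χ₃ (s (2 * k))) +ℤ χ₃ (s (1 + 2 * k))       ≡⟨ +-assoc (Δ (2 * k)) _ _ ⟩
  Δ (2 * k) +ℤ (χ₃ (s (2 * k)) +ℤ χ₃ (s (1 + 2 * k)))       ≡⟨ cong₂ (λ u v → Δ (2 * k) +ℤ (χ₃ u +ℤ χ₃ v)) (s-double k) (s-double+1 k) ⟩
  Δ (2 * k) +ℤ (χ₃ (s k) +ℤ χ₃ (s k + s (suc k)))           ∎

+-cancel-pair : ∀ d p q {u v} → u +ℤ v ≡ 0ℤ → (d +ℤ (p +ℤ u)) +ℤ (q +ℤ v) ≡ d +ℤ (p +ℤ q)
+-cancel-pair d p q {u} {v} u+v≡0 = begin
  (d +ℤ (p +ℤ u)) +ℤ (q +ℤ v)   ≡⟨ interchange d p u q v ⟩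
  (d +ℤ (p +ℤ q)) +ℤ (u +ℤ v)   ≡⟨ cong ((d +ℤ (p +ℤ q)) +ℤ_) u+v≡0 ⟩
  (d +ℤ (p +ℤ q)) +ℤ 0ℤ         ≡⟨ +-identityʳ _ ⟩
  d +ℤ (p +ℤ q)                 ∎
  where
  interchange : ∀ (d p u q v : ℤ) → (d +ℤ (p +ℤ u)) +ℤ (q +ℤ v) ≡ (d +ℤ (p +ℤ q)) +ℤ (u +ℤ v)
  interchange = ℤ-Solver.solve-∀

Δ-quadruple-suc : ∀ m → Δ (4 * suc m) ≡ Δ (4 * m) +ℤ (χ₃ (s m) +ℤ χ₃ (s m + s (suc m)))
Δ-quadruple-suc m = begin
  Δ (4 * suc m)
    ≡⟨ cong Δ (4*[1+m]≡2*[2+2*m] m) ⟩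
  Δ (2 * suc (suc n))
    ≡⟨ Δ-double-suc (suc n) ⟩
  Δ (2 * suc n) +ℤ (χ₃ y +ℤ χ₃ (y + z))
    ≡⟨ cong (_+ℤ (χ₃ y +ℤ χ₃ (y + z))) (Δ-double-suc n) ⟩
  (Δ (2 * n) +ℤ (χ₃ x +ℤ χ₃ (x + y))) +ℤ (χ₃ y +ℤ χ₃ (y + z))
    ≡⟨ +-cancel-pair (Δ (2 * n)) (χ₃ x) (χ₃ y) (χ₃-cancel (x + y) (y + z) (3∣[x+y]+[y+z] x y z (s-double+1≡neighbours m))) ⟩
  Δ (2 * n) +ℤ (χ₃ x +ℤ χ₃ y)
    ≡⟨ cong₂ _+ℤ_ (cong Δ (sym (*-assoc 2 2 m))) (cong₂ (λ u v → χ₃ u +ℤ χ₃ v) (s-double m) (s-double+1 m)) ⟩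
  Δ (4 * m) +ℤ (χ₃ (s m) +ℤ χ₃ (s m + s (suc m)))
    ∎
  where
  n x y z : ℕ
  n = 2 * m
  x = s n
  y = s (suc n)
  z = s (suc (suc n))
  4*[1+m]≡2*[2+2*m] : ∀ m → 4 * suc m ≡ 2 * suc (suc (2 * m))
  4*[1+m]≡2*[2+2*m] = ℕ-Solver.solve-∀

lemma5p5 : (N : ℕ) → Δ (2 * N) ≡ Δ (4 * N)
lemma5p5 zero    = refl
lemma5p5 (suc m) = begin
  Δ (2 * suc m)     ≡⟨ Δ-double-suc m ⟩
  Δ (2 * m) +ℤ c    ≡⟨ cong (_+ℤ c) (lemma5p5 m) ⟩
  Δ (4 * m) +ℤ c    ≡⟨ Δ-quadruple-suc m ⟨
  Δ (4 * suc m)     ∎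
  where
  c : ℤ
  c = χ₃ (s m) +ℤ χ₃ (s m + s (suc m))
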